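{- Let $n,k,j$ be nonnegative integers with $3\leq k\leq n$ and $n-k+3\leq j\leq n$. Then the word $B=W^{(k)}_{n-k+2}\,k$ (the word $W^{(k)}_{n-k+2}$ followed by the digit $k$) is not a factor of $W^{(k)}_j$.
   Context: Words are over $\mathbb{N}$. Define the morphism $\varphi_k$ by $\varphi_k(ki+j)=(ki)(ki+j+1)$ if $0\le j\le k-2$ and $\varphi_k(ki+j)=(ki+j+1)$ if $j=k-1$; let $W^{(k)}_n=\varphi_k^n(0)$. -}

module Defs where

open import Data.Nat using (ℕ; zero; suc; _+_; _*_; _<?_; NonZero)
open import Data.Nat.DivMod using (_/_; _%_)
open import Data.List using (List; []; _∷_; _++_; concatMap)
open import Data.Product using (∃-syntax; _×_)
open import Relation.Nullary using (yes; no)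
open import Relation.Binary.PropositionalEquality using (_≡_)

φ-letter : (k : ℕ) → .{{NonZero k}} → ℕ → List ℕ
φ-letter k m with suc (m % k) <? k
... | yes _ = k * (m / k) ∷ suc m ∷ []
... | no  _ = suc m ∷ []

φ : (k : ℕ) → .{{NonZero k}} → List ℕ → List ℕ
φ k w = concatMap (φ-letter k) w

φ^ : (k : ℕ) → .{{NonZero k}} → ℕ → List ℕ → List ℕ
φ^ k zero    w = w
φ^ k (suc n) w = φ k (φ^ k n w)

W : (k : ℕ) → .{{NonZero k}} → ℕ → List ℕ
W k n = φ^ k n (0 ∷ [])

IsFactor : List ℕ → List ℕ → Set
IsFactor u w = ∃[ p ] ∃[ s ] (p ++ u ++ s ≡ w)

-- The letters of φ_k(w) that are multiples of k are exactly the first letters of the images of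
-- the letters of w.  Hence an occurrence of W_{a+1} = φ_k(W_a), which starts with 0, followed by
-- a letter x in W_{b+1} = φ_k(W_b) is the image of an occurrence of W_a followed by a letter y in
-- W_b, where x is the first letter of φ_k(y): so k ∣ x, and y ≠ 0 when x ≠ 0.  The only way to
-- misread φ_k(W_a) is at a last letter c ≡ k-1 (mod k) of W_a, whose image c+1 is also the first
-- letter of the image of some d; this is excluded by two adjacency invariants of the words W
-- (a letter q after p satisfies q < p + k, and p = k⌊q/k⌋ when k ∤ q).  Descending, one
-- reaches either W_1 x inside W_m with k ≤ x, or W_{a'} x inside W_0 with x ≠ 0; as the letters
-- of W_m are at most m, neither can happen when b < a + k.
module Submission where

open import Defs
open import Data.Nat.Base
open import Data.Nat.Properties
open import Data.Nat.DivMod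
open import Data.Nat.Divisibility using (_∣_; _∤_; divides; _∣0; m∣m*n; n∣m⇒m%n≡0; ∣⇒≤)
open import Data.List.Base using (List; []; _∷_; _++_; _∷ʳ_; initLast; _∷ʳ′_)
open import Data.List.Properties using (++-assoc; ∷-injectiveˡ; ∷-injectiveʳ)
open import Data.List.Relation.Unary.All as All using (All; []; _∷_)
open import Data.List.Relation.Unary.All.Properties using (++⁺; ++⁻ʳ)
open import Data.List.Relation.Unary.Linked as Linked using (Linked; []; [-]; _∷_)
open import Data.Product using (∃-syntax; ∃₂; _×_; _,_)
open import Data.Empty using (⊥-elim)
open import Relation.Nullary using (¬_; yes; no; contradiction)
open import Relation.Binary.PropositionalEquality

module _ {A : Set} {R : A → A → Set} where

  linked-++⁻ʳ : ∀ xs {ys} → Linked R (xs ++ ys) → Linked R ys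
  linked-++⁻ʳ []       r = r
  linked-++⁻ʳ (_ ∷ xs) r = linked-++⁻ʳ xs (Linked.tail r)

  linked-adjacent : ∀ xs {p q ys} → Linked R ((xs ∷ʳ p) ++ q ∷ ys) → R p q
  linked-adjacent []       (r ∷ _) = r
  linked-adjacent (_ ∷ xs) r       = linked-adjacent xs (Linked.tail r)

module _ (k : ℕ) .{{_ : NonZero k}} where

  data Image (c : ℕ) : List ℕ → Set where
    inner : suc (c % k) < k → Image c (k * (c / k) ∷ suc c ∷ [])
    final : suc (c % k) ≡ k → Image c (suc c ∷ [])

  image : ∀ c → Image c (φ-letter k c)
  image c with suc (c % k) <? k
  ... | yes h = inner h
  ... | no  h = final (≤-antisym (m%n<n c k) (≮⇒≥ h))

  k*[c/k]≤c : ∀ c → k * (c / k) ≤ c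
  k*[c/k]≤c c = subst (_≤ c) (*-comm (c / k) k) (m/n*n≤m c k)

  suc-divMod : ∀ c → suc c ≡ suc (c % k) + (c / k) * k
  suc-divMod c = cong suc (m≡m%n+[m/n]*n c k)

  inner-suc-% : ∀ {c} → suc (c % k) < k → suc c % k ≡ suc (c % k)
  inner-suc-% {c} h = begin
    suc c % k                           ≡⟨ %-congˡ (suc-divMod c) ⟩
    (suc (c % k) + (c / k) * k) % k     ≡⟨ [m+kn]%n≡m%n (suc (c % k)) (c / k) k ⟩
    suc (c % k) % k                     ≡⟨ m<n⇒m%n≡m h ⟩
    suc (c % k)                         ∎
    where open ≡-Reasoning

  inner⇒∤ : ∀ {c} → suc (c % k) < k → k ∤ suc c
  inner⇒∤ {c} h k∣ = 0≢1+n (trans (sym (n∣m⇒m%n≡0 (suc c) k k∣)) (inner-suc-% h))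

  final⇒∣ : ∀ {c} → suc (c % k) ≡ k → k ∣ suc c
  final⇒∣ {c} h = divides (suc (c / k)) (trans (suc-divMod c) (cong (_+ (c / k) * k) h))

  final⇒∤ : 1 < k → ∀ {c} → suc (c % k) ≡ k → k ∤ c
  final⇒∤ 1<k {c} h k∣c = <⇒≢ 1<k (trans (cong suc (sym (n∣m⇒m%n≡0 c k k∣c))) h)

  image-head-∣ : ∀ {c l t y ys} → Image c l → l ++ t ≡ y ∷ ys → k ∣ y
  image-head-∣ {c} (inner _) refl = m∣m*n (c / k)
  image-head-∣     (final h) refl = final⇒∣ h

  φ-head-∣ : ∀ w {y ys} → φ k w ≡ y ∷ ys → k ∣ y
  φ-head-∣ (c ∷ _) = image-head-∣ (image c)

  φ-letter-0 : 1 < k → φ-letter k 0 ≡ 0 ∷ 1 ∷ []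
  φ-letter-0 1<k with φ-letter k 0 | image 0
  ... | _ | inner _ = cong (λ z → z ∷ 1 ∷ []) (trans (cong (k *_) (0/n≡0 k)) (*-zeroʳ k))
  ... | _ | final h = contradiction (k ∣0) (final⇒∤ 1<k h)

  φ-head-≢0 : 1 < k → ∀ {y w x s} → φ k (y ∷ w) ≡ x ∷ s → x ≢ 0 → y ≢ 0
  φ-head-≢0 1<k {w = w} φ≡ x≢0 refl =
    x≢0 (sym (∷-injectiveˡ (trans (sym (cong (_++ φ k w) (φ-letter-0 1<k))) φ≡)))

  W-head : 1 < k → ∀ a → ∃[ t ] W k a ≡ 0 ∷ t
  W-head _   zero    = [] , refl
  W-head 1<k (suc a) with W-head 1<k a
  ... | t , W≡ = 1 ∷ φ k t , trans (cong (φ k) W≡) (cong (_++ φ k t) (φ-letter-0 1<k))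

  image-≤ : ∀ {c l} → Image c l → All (_≤ suc c) l
  image-≤ {c} (inner _) = ≤-trans (k*[c/k]≤c c) (n≤1+n c) ∷ ≤-refl ∷ []
  image-≤     (final _) = ≤-refl ∷ []

  φ-≤ : ∀ {m w} → All (_≤ m) w → All (_≤ suc m) (φ k w)
  φ-≤ []                      = []
  φ-≤ {w = c ∷ _} (c≤m ∷ w≤m) =
    ++⁺ (All.map (λ x≤ → ≤-trans x≤ (s≤s c≤m)) (image-≤ (image c))) (φ-≤ w≤m)

  W-≤ : ∀ b → All (_≤ b) (W k b)
  W-≤ zero    = z≤n ∷ []
  W-≤ (suc b) = φ-≤ (W-≤ b)

  Near : ℕ → ℕ → Set
  Near p q = q < p + k

  inner-near : ∀ {c} → suc (c % k) < k → Near (k * (c / k)) (suc c)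
  inner-near {c} h = begin-strict
    suc c                      ≡⟨ suc-divMod c ⟩
    suc (c % k) + (c / k) * k  <⟨ +-monoˡ-< ((c / k) * k) h ⟩
    k + (c / k) * k            ≡⟨ +-comm k ((c / k) * k) ⟩
    (c / k) * k + k            ≡⟨ cong (_+ k) (*-comm (c / k) k) ⟩
    k * (c / k) + k            ∎
    where open ≤-Reasoning

  near-across : ∀ {c d y} → Near c d → y ≤ suc d → Near (suc c) y
  near-across c~d y≤ = ≤-trans (s≤s y≤) (s≤s c~d)

  suc-∷-φ-near : ∀ {c w} → Linked Near (c ∷ w) → Linked Near (suc c ∷ φ k w)
  suc-∷-φ-near [-]                    = [-]
  suc-∷-φ-near {c} {d ∷ w} (c~d ∷ dw) = join (image d) (suc-∷-φ-near dw)
    where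
      join : ∀ {l} → Image d l → Linked Near (suc d ∷ φ k w) → Linked Near (suc c ∷ l ++ φ k w)
      join (inner h) rest = near-across c~d (≤-trans (k*[c/k]≤c d) (n≤1+n d)) ∷ inner-near h ∷ rest
      join (final _) rest = near-across c~d ≤-refl ∷ rest

  image-++-near : ∀ {c l r} → Image c l → Linked Near (suc c ∷ r) → Linked Near (l ++ r)
  image-++-near (inner h) r = inner-near h ∷ r
  image-++-near (final _) r = r

  φ-near : ∀ {w} → Linked Near w → Linked Near (φ k w)
  φ-near {[]}    _  = []
  φ-near {c ∷ _} cw = image-++-near (image c) (suc-∷-φ-near cw)

  W-near : ∀ b → Linked Near (W k b)
  W-near zero    = [-]
  W-near (suc b) = φ-near (W-near b)

  Based : ℕ → ℕ → Set
  Based p q = k ∤ q → p + q % k ≡ q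

  inner-based : ∀ {c} → suc (c % k) < k → Based (k * (c / k)) (suc c)
  inner-based {c} h _ = begin
    k * (c / k) + suc c % k        ≡⟨ cong (k * (c / k) +_) (inner-suc-% h) ⟩
    k * (c / k) + suc (c % k)      ≡⟨ +-comm (k * (c / k)) (suc (c % k)) ⟩
    suc (c % k) + k * (c / k)      ≡⟨ cong (suc (c % k) +_) (*-comm k (c / k)) ⟩
    suc (c % k) + (c / k) * k      ≡⟨ suc-divMod c ⟨
    suc c                          ∎
    where open ≡-Reasoning

  ∷-φ-based : ∀ x w → Linked Based (φ k w) → Linked Based (x ∷ φ k w)
  ∷-φ-based x w r with φ k w in eq
  ... | []    = [-]
  ... | _ ∷ _ = contradiction (φ-head-∣ w eq) ∷ r

  φ-based : ∀ w → Linked Based (φ k w)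
  φ-based []      = []
  φ-based (c ∷ w) = prepend (image c)
    where
      prepend : ∀ {l} → Image c l → Linked Based (l ++ φ k w)
      prepend (inner h) = inner-based h ∷ ∷-φ-based _ w (φ-based w)
      prepend (final _) = ∷-φ-based _ w (φ-based w)

  W-based : ∀ a → Linked Based (W k a)
  W-based zero    = [-]
  W-based (suc a) = φ-based (W k a)

  final-near-based-⊥ : 1 < k → ∀ {e c d} → suc (c % k) ≡ k → Based e c → Near e d →
                       k * (d / k) ≢ suc c
  final-near-based-⊥ 1<k {e} {c} {d} fin e-c e~d k[d/k]≡ = <-irrefl refl (begin-strict
    d                <⟨ e~d ⟩
    e + k            ≡⟨ cong (e +_) fin ⟨
    e + suc (c % k)  ≡⟨ +-suc e (c % k) ⟩
    suc (e + c % k)  ≡⟨ cong suc (e-c (final⇒∤ 1<k fin)) ⟩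
    suc c            ≡⟨ k[d/k]≡ ⟨
    k * (d / k)      ≤⟨ k*[c/k]≤c d ⟩
    d                ∎)
    where open ≤-Reasoning

  ImageOfSuffix : List ℕ → List ℕ → Set
  ImageOfSuffix v w = ∃₂ λ w₁ w₂ → w ≡ w₁ ++ w₂ × φ k w₂ ≡ v

  ∷-imageOfSuffix : ∀ {c v w} → ImageOfSuffix v w → ImageOfSuffix v (c ∷ w)
  ∷-imageOfSuffix {c} (w₁ , w₂ , w≡ , φ≡) = c ∷ w₁ , w₂ , cong (c ∷_) w≡ , φ≡

  φ-cut : ∀ w p {y q} → φ k w ≡ p ++ y ∷ q → k ∣ y → ImageOfSuffix (y ∷ q) w
  φ-cut []      []      () _
  φ-cut []      (_ ∷ _) () _
  φ-cut (c ∷ w) []      eq _   = [] , c ∷ w , refl , eq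
  φ-cut (c ∷ w) (z ∷ p) {y} {q} eq k∣y = skip p (image c) eq
    where
      skip : ∀ p′ {l} → Image c l → l ++ φ k w ≡ z ∷ p′ ++ y ∷ q →
             ImageOfSuffix (y ∷ q) (c ∷ w)
      skip p′       (final _) eq′ = ∷-imageOfSuffix (φ-cut w p′ (∷-injectiveʳ eq′) k∣y)
      skip []       (inner h) eq′ =
        contradiction (subst (k ∣_) (sym (∷-injectiveˡ (∷-injectiveʳ eq′))) k∣y) (inner⇒∤ h)
      skip (_ ∷ p′) (inner _) eq′ =
        ∷-imageOfSuffix (φ-cut w p′ (∷-injectiveʳ (∷-injectiveʳ eq′)) k∣y)

  data Desubstitution (u w r : List ℕ) : Set where
    aligned    : ∀ w′ → w ≡ u ++ w′ → φ k w′ ≡ r → Desubstitution u w r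
    misaligned : ∀ init {c d} rest → u ≡ init ∷ʳ c → w ≡ init ++ d ∷ rest →
                 suc (c % k) ≡ k → k * (d / k) ≡ suc c → Desubstitution u w r

  ∷-desubstitution : ∀ {c u w r} → Desubstitution u w r → Desubstitution (c ∷ u) (c ∷ w) r
  ∷-desubstitution {c} (aligned w′ w≡ φ≡) = aligned w′ (cong (c ∷_) w≡) φ≡
  ∷-desubstitution {c} (misaligned init rest u≡ w≡ fin blk) =
    misaligned (c ∷ init) rest (cong (c ∷_) u≡) (cong (c ∷_) w≡) fin blk

  desubstitute : ∀ u w r → φ k w ≡ φ k u ++ r → Desubstitution u w r
  desubstitute []      w       r eq = aligned w refl eq
  desubstitute (c ∷ u) []      r eq = ⊥-elim (nonempty (image c) eq)
    where
      nonempty : ∀ {l} → Image c l → [] ≢ (l ++ φ k u) ++ r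
      nonempty (inner _) ()
      nonempty (final _) ()
  desubstitute (c ∷ u) (d ∷ w) r eq = match (image c) (image d) eq
    where
      same : c ≡ d → φ k w ≡ φ k u ++ r → Desubstitution (c ∷ u) (d ∷ w) r
      same c≡d eq′ = subst (λ d → Desubstitution (c ∷ u) (d ∷ w) r) c≡d
                           (∷-desubstitution (desubstitute u w r eq′))

      realign : ∀ {u′} → suc (d % k) < k → suc (c % k) ≡ k → k * (d / k) ≡ suc c →
                suc d ∷ φ k w ≡ φ k u′ ++ r → Desubstitution (c ∷ u′) (d ∷ w) r
      realign {[]}     _ fin blk _   = misaligned [] w refl refl fin blk
      realign {e ∷ u′} h _   _   eq′ =
        contradiction (image-head-∣ (image e) (trans (sym (++-assoc _ (φ k u′) r)) (sym eq′)))
                      (inner⇒∤ h)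

      match : ∀ {l l′} → Image c l → Image d l′ → l′ ++ φ k w ≡ (l ++ φ k u) ++ r →
              Desubstitution (c ∷ u) (d ∷ w) r
      match (inner _) (inner _) eq′ =
        same (suc-injective (∷-injectiveˡ (∷-injectiveʳ (sym eq′))))
             (∷-injectiveʳ (∷-injectiveʳ eq′))
      match (final _) (final _) eq′ =
        same (suc-injective (sym (∷-injectiveˡ eq′))) (∷-injectiveʳ eq′)
      match (inner h) (final _) eq′ = contradiction (φ-head-∣ w (∷-injectiveʳ eq′)) (inner⇒∤ h)
      match (final fin) (inner h) eq′ = realign h fin (∷-injectiveˡ eq′) (∷-injectiveʳ eq′)

  W-desubstitution-aligned : 1 < k → ∀ a b {w₁ w₂ r} → W k b ≡ w₁ ++ w₂ →
                             Desubstitution (W k a) w₂ r →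
                             ∃[ w′ ] w₂ ≡ W k a ++ w′ × φ k w′ ≡ r
  W-desubstitution-aligned _ _ _ _ (aligned w′ w₂≡ φ≡) = w′ , w₂≡ , φ≡
  W-desubstitution-aligned 1<k a b Wb≡ (misaligned init _ Wa≡ _ fin _) with initLast init
  ... | [] with W-head 1<k a
  ...   | _ , W≡ with ∷-injectiveˡ (trans (sym Wa≡) W≡)
  ...     | refl = contradiction (k ∣0) (final⇒∤ 1<k fin)
  W-desubstitution-aligned 1<k a b {w₁} Wb≡ (misaligned _ {c} {d} rest Wa≡ w₂≡ fin blk) | u ∷ʳ′ e =
    ⊥-elim (final-near-based-⊥ 1<k fin e-c e~d blk)
    where
      e-c : Based e c
      e-c = linked-adjacent u (subst (Linked Based) Wa≡ (W-based a))
      e~d : Near e d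
      e~d = linked-adjacent u (linked-++⁻ʳ w₁ (subst (Linked Near) Wb≡′ (W-near b)))
        where
          Wb≡′ : W k b ≡ w₁ ++ (u ∷ʳ e) ++ d ∷ rest
          Wb≡′ = trans Wb≡ (cong (w₁ ++_) w₂≡)

  data Occurs (a x b : ℕ) : Set where
    occurs : ∀ p s → p ++ W k a ++ x ∷ s ≡ W k b → Occurs a x b

  occurs-≤ : ∀ {a x b} → Occurs a x b → x ≤ b
  occurs-≤ {a} {x} {b} (occurs p s occ) =
    All.head (++⁻ʳ (W k a) (++⁻ʳ p (subst (All (_≤ b)) (sym occ) (W-≤ b))))

  occurs-desubstitute : 1 < k → ∀ {a x b} → Occurs (suc a) x (suc b) →
                        ∃[ y ] Occurs a y b × ∃₂ λ w s → φ k (y ∷ w) ≡ x ∷ s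
  occurs-desubstitute 1<k {a} {x} {b} (occurs p s occ) with W-head 1<k (suc a)
  ... | t , W≡ with φ-cut (W k b) p (trans (sym occ) (cong (λ v → p ++ v ++ x ∷ s) W≡)) (k ∣0)
  ... | w₁ , w₂ , Wb≡ , φw₂≡
      with W-desubstitution-aligned 1<k a b Wb≡
             (desubstitute (W k a) w₂ (x ∷ s) (trans φw₂≡ (cong (_++ x ∷ s) (sym W≡))))
  ... | y ∷ w′ , w₂≡ , φ≡ = y , occurs w₁ w′ (sym (trans Wb≡ (cong (w₁ ++_) w₂≡))) , w′ , s , φ≡

  W-not-followed : 1 < k → ∀ a b {x} → x ≢ 0 → b < a + k → ¬ Occurs (suc a) x b
  W-not-followed _   a       zero    x≢0 _ occ = x≢0 (n≤0⇒n≡0 (occurs-≤ occ))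
  W-not-followed 1<k zero    (suc b) x≢0 b<k occ with occurs-desubstitute 1<k occ
  ... | y , _ , w , _ , φ≡ =
    <⇒≱ b<k (≤-trans (∣⇒≤ {{≢-nonZero x≢0}} (φ-head-∣ (y ∷ w) φ≡)) (occurs-≤ occ))
  W-not-followed 1<k (suc a) (suc b) x≢0 b<a+k occ with occurs-desubstitute 1<k occ
  ... | y , occ′ , w , _ , φ≡ =
    W-not-followed 1<k a b (φ-head-≢0 1<k {y} {w} φ≡ x≢0) (≤-pred b<a+k) occ′

lemma11 : (n k j : ℕ) → .{{_ : NonZero k}} → 3 ≤ k → k ≤ n → n ∸ k + 3 ≤ j → j ≤ n →
    ¬ IsFactor (W k (n ∸ k + 2) ++ k ∷ []) (W k j)
lemma11 n k j 3≤k k≤n _ j≤n (p , s , eq) =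
  W-not-followed k (<⇒≤ 3≤k) (n ∸ k + 1) j (≢-nonZero⁻¹ k) j<a+k (occurs p s occ)
  where
    open ≡-Reasoning
    a+k≡1+n : n ∸ k + 1 + k ≡ suc n
    a+k≡1+n = begin
      n ∸ k + 1 + k    ≡⟨ +-assoc (n ∸ k) 1 k ⟩
      n ∸ k + suc k    ≡⟨ +-suc (n ∸ k) k ⟩
      suc (n ∸ k + k)  ≡⟨ cong suc (m∸n+n≡m k≤n) ⟩
      suc n            ∎
    j<a+k : j < n ∸ k + 1 + k
    j<a+k = subst (j <_) (sym a+k≡1+n) (s≤s j≤n)
    occ : p ++ W k (suc (n ∸ k + 1)) ++ k ∷ s ≡ W k j
    occ = begin
      p ++ W k (suc (n ∸ k + 1)) ++ k ∷ s     ≡⟨ cong (λ i → p ++ W k i ++ k ∷ s) (+-suc (n ∸ k) 1) ⟨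
      p ++ W k (n ∸ k + 2) ++ k ∷ s           ≡⟨ cong (p ++_) (++-assoc (W k (n ∸ k + 2)) (k ∷ []) s) ⟨
      p ++ (W k (n ∸ k + 2) ++ k ∷ []) ++ s   ≡⟨ eq ⟩
      W k j                                   ∎
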